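{- Let $G$ be a bipartite (simple) graph with Laplacian matrix $L_G$. Then \[ \operatorname{per}(L_G\circ L_G)\ \le\ \bigl(\operatorname{per}(L_G)\bigr)^2. \]
   Context: Graphs are simple (undirected, no loops, no multiple edges) on vertex set $\{1,\dots,n\}$. The Laplacian is $L_G=D_G-A_G$, where $A_G$ is the adjacency matrix and $D_G$ the diagonal matrix of vertex degrees. $\operatorname{per}(A)=\sum_{\sigma\in S_n}\prod_{i} a_{i,\sigma(i)}$ is the permanent and $\circ$ denotes the Hadamard (entrywise) product. -}

module Defs where

open import Data.Nat using (ℕ; zero; suc)
open import Data.Fin using (Fin; zero; suc; punchIn)
open import Data.Bool using (Bool; true; false; if_then_else_)
open import Data.Integer using (ℤ; +_; _+_; _*_; _-_; -[1+_])
open import Data.Product using (Σ; _×_)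
open import Relation.Binary.PropositionalEquality using (_≡_; _≢_)
open import Relation.Nullary using (¬_)

Matrix : ℕ → Set
Matrix n = Fin n → Fin n → ℤ

∑ : ∀ {n} → (Fin n → ℤ) → ℤ
∑ {zero}  f = + 0
∑ {suc n} f = f zero + ∑ (λ i → f (suc i))

-- Permanent, per A = Σ_{σ ∈ S_n} Π_i a_{i,σ(i)}, computed by the
-- (equivalent, standard) expansion along the first row:
-- per A = Σ_j a_{0 j} per(A with row 0 and column j deleted).
per : ∀ {n} → Matrix n → ℤ
per {zero}  A = + 1
per {suc n} A = ∑ (λ j → A zero j * per (λ i k → A (suc i) (punchIn j k)))

_∘ₕ_ : ∀ {n} → Matrix n → Matrix n → Matrix n
(A ∘ₕ B) i j = A i j * B i j

record SimpleGraph (n : ℕ) : Set where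
  field
    adj   : Fin n → Fin n → Bool
    sym   : ∀ i j → adj i j ≡ adj j i
    loopless : ∀ i → adj i i ≡ false
open SimpleGraph public

IsBipartite : ∀ {n} → SimpleGraph n → Set
IsBipartite {n} G =
  Σ (Fin n → Bool) λ c → ∀ i j → adj G i j ≡ true → c i ≢ c j

toℤ : Bool → ℤ
toℤ b = if b then + 1 else + 0

adjMatrix : ∀ {n} → SimpleGraph n → Matrix n
adjMatrix G i j = toℤ (adj G i j)

degree : ∀ {n} → SimpleGraph n → Fin n → ℤ
degree G i = ∑ (λ j → adjMatrix G i j)

degMatrix : ∀ {n} → SimpleGraph n → Matrix n
degMatrix G i j with i Data.Fin.≟ j
... | Relation.Nullary.yes _ = degree G i
... | Relation.Nullary.no  _ = + 0

laplacian : ∀ {n} → SimpleGraph n → Matrix n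
laplacian G i j = degMatrix G i j - adjMatrix G i j

{-# OPTIONS --safe #-}
module Submission where

-- Give the two colour classes of the bipartition the signs +1 and -1. Every
-- edge joins vertices of opposite sign, so L = S Q S, where S is the diagonal
-- sign matrix and Q = D + A is the signless Laplacian. Hence per L = per Q and
-- L ∘ L = Q ∘ Q, and it remains to show per (P ∘ P) ≤ (per P)² for entrywise
-- nonnegative P. Expanding along the first row, with pⱼ = P₀ⱼ and Pⱼ the minor,
-- induction gives  per (P ∘ P) = Σⱼ pⱼ² per (Pⱼ ∘ Pⱼ) ≤ Σⱼ (pⱼ per Pⱼ)²,
-- and a sum of squares of nonnegative numbers is at most the square of the sum.

open import Defs hiding (sym)
open import Data.Nat using (ℕ; zero; suc; z≤n)
open import Data.Fin using (Fin; zero; suc; punchIn; _≟_)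
open import Data.Bool using (Bool; true; false)
open import Data.Integer using (ℤ; +_; 0ℤ; 1ℤ; -1ℤ; _+_; _-_; _*_; _≤_; +≤+; nonNegative)
open import Data.Integer.Properties
  using (≤-refl; +-mono-≤; +-monoʳ-≤; i≤i+j; *-monoˡ-≤-nonNeg; *-zeroʳ; *-identityˡ;
         +-identityʳ; *-distribˡ-+; module ≤-Reasoning)
open import Data.Integer.Tactic.RingSolver using (solve-∀)
open import Data.Product using (_,_)
open import Data.Empty using (⊥-elim)
open import Relation.Nullary using (yes; no)
open import Relation.Binary.PropositionalEquality
  using (_≡_; _≢_; refl; sym; trans; cong; cong₂; subst; module ≡-Reasoning)

0≤i*j : ∀ {i j} → 0ℤ ≤ i → 0ℤ ≤ j → 0ℤ ≤ i * j
0≤i*j {i} 0≤i 0≤j = subst (_≤ i * _) (*-zeroʳ i) (*-monoˡ-≤-nonNeg i {{nonNegative 0≤i}} 0≤j)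

∑-cong : ∀ {n} {f g : Fin n → ℤ} → (∀ i → f i ≡ g i) → ∑ f ≡ ∑ g
∑-cong {zero}  f≡g = refl
∑-cong {suc n} f≡g = cong₂ _+_ (f≡g zero) (∑-cong (λ i → f≡g (suc i)))

∑-mono-≤ : ∀ {n} {f g : Fin n → ℤ} → (∀ i → f i ≤ g i) → ∑ f ≤ ∑ g
∑-mono-≤ {zero}  f≤g = ≤-refl
∑-mono-≤ {suc n} f≤g = +-mono-≤ (f≤g zero) (∑-mono-≤ (λ i → f≤g (suc i)))

0≤∑ : ∀ {n} {f : Fin n → ℤ} → (∀ i → 0ℤ ≤ f i) → 0ℤ ≤ ∑ f
0≤∑ {zero}  0≤f = ≤-refl
0≤∑ {suc n} 0≤f = +-mono-≤ (0≤f zero) (0≤∑ (λ i → 0≤f (suc i)))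

*-distribˡ-∑ : ∀ {n} c (f : Fin n → ℤ) → c * ∑ f ≡ ∑ (λ i → c * f i)
*-distribˡ-∑ {zero}  c f = *-zeroʳ c
*-distribˡ-∑ {suc n} c f =
  trans (*-distribˡ-+ c (f zero) _) (cong (λ t → c * f zero + t) (*-distribˡ-∑ c (λ i → f (suc i))))

∑-square≤square-∑ : ∀ {n} (x : Fin n → ℤ) → (∀ i → 0ℤ ≤ x i) →
  ∑ (λ i → x i * x i) ≤ ∑ x * ∑ x
∑-square≤square-∑ {zero}  x 0≤x = ≤-refl
∑-square≤square-∑ {suc n} x 0≤x = begin
  a * a + ∑ (λ i → x (suc i) * x (suc i))
    ≤⟨ +-monoʳ-≤ (a * a) (∑-square≤square-∑ _ (λ i → 0≤x (suc i))) ⟩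
  a * a + s * s                           ≤⟨ i≤i+j _ _ {{nonNegative (+-mono-≤ 0≤as 0≤as)}} ⟩
  a * a + s * s + (a * s + a * s)         ≡⟨ square-+ a s ⟩
  (a + s) * (a + s)                       ∎
  where
  open ≤-Reasoning
  a s : ℤ
  a = x zero
  s = ∑ (λ i → x (suc i))
  0≤as : 0ℤ ≤ a * s
  0≤as = 0≤i*j (0≤x zero) (0≤∑ (λ i → 0≤x (suc i)))
  square-+ : ∀ a s → a * a + s * s + (a * s + a * s) ≡ (a + s) * (a + s)
  square-+ = solve-∀

∏ : ∀ {n} → (Fin n → ℤ) → ℤ
∏ {zero}  f = 1ℤ
∏ {suc n} f = f zero * ∏ (λ i → f (suc i))

∏-punchIn : ∀ {n} (f : Fin (suc n) → ℤ) j → ∏ f ≡ f j * ∏ (λ k → f (punchIn j k))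
∏-punchIn         f zero    = refl
∏-punchIn {suc n} f (suc j) =
  trans (cong (f zero *_) (∏-punchIn (λ i → f (suc i)) j)) (swap (f zero) (f (suc j)) _)
  where
  swap : ∀ a b c → a * (b * c) ≡ b * (a * c)
  swap = solve-∀

∏-square≡1 : ∀ {n} (s : Fin n → ℤ) → (∀ i → s i * s i ≡ 1ℤ) → ∏ s * ∏ s ≡ 1ℤ
∏-square≡1 {zero}  s s²≡1 = refl
∏-square≡1 {suc n} s s²≡1 = begin
  (s zero * ∏ s′) * (s zero * ∏ s′)   ≡⟨ interchange (s zero) (∏ s′) ⟩
  (s zero * s zero) * (∏ s′ * ∏ s′)   ≡⟨ cong₂ _*_ (s²≡1 zero) (∏-square≡1 s′ (λ i → s²≡1 (suc i))) ⟩
  1ℤ                                   ∎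
  where
  open ≡-Reasoning
  s′ : Fin n → ℤ
  s′ i = s (suc i)
  interchange : ∀ a b → (a * b) * (a * b) ≡ (a * a) * (b * b)
  interchange = solve-∀

minor : ∀ {n} → Matrix (suc n) → Fin (suc n) → Matrix n
minor A j i k = A (suc i) (punchIn j k)

per-cong : ∀ {n} {A B : Matrix n} → (∀ i j → A i j ≡ B i j) → per A ≡ per B
per-cong {zero}  A≡B = refl
per-cong {suc n} A≡B =
  ∑-cong (λ j → cong₂ _*_ (A≡B zero j) (per-cong (λ i k → A≡B (suc i) (punchIn j k))))

0≤per : ∀ {n} (P : Matrix n) → (∀ i j → 0ℤ ≤ P i j) → 0ℤ ≤ per P
0≤per {zero}  P 0≤P = +≤+ z≤n
0≤per {suc n} P 0≤P =
  0≤∑ (λ j → 0≤i*j (0≤P zero j) (0≤per (minor P j) (λ i k → 0≤P (suc i) (punchIn j k))))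

per-scale : ∀ {n} (r c : Fin n → ℤ) (P : Matrix n) →
  per (λ i j → r i * c j * P i j) ≡ ∏ r * ∏ c * per P
per-scale {zero}  r c P = refl
per-scale {suc n} r c P =
  trans (∑-cong expand) (sym (*-distribˡ-∑ (∏ r * ∏ c) (λ j → P zero j * per (minor P j))))
  where
  open ≡-Reasoning
  r′ : Fin n → ℤ
  r′ i = r (suc i)
  c′ : Fin (suc n) → Fin n → ℤ
  c′ j k = c (punchIn j k)
  regroup : ∀ a b c d p q → a * c * p * (b * d * q) ≡ (a * b) * (c * d) * (p * q)
  regroup = solve-∀
  expand : ∀ j → r zero * c j * P zero j * per (λ i k → r′ i * c′ j k * minor P j i k)
               ≡ ∏ r * ∏ c * (P zero j * per (minor P j))
  expand j = begin
    r zero * c j * P zero j * per (λ i k → r′ i * c′ j k * minor P j i k)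
      ≡⟨ cong (r zero * c j * P zero j *_) (per-scale r′ (c′ j) (minor P j)) ⟩
    r zero * c j * P zero j * (∏ r′ * ∏ (c′ j) * per (minor P j))
      ≡⟨ regroup (r zero) (∏ r′) (c j) (∏ (c′ j)) (P zero j) (per (minor P j)) ⟩
    ∏ r * (c j * ∏ (c′ j)) * (P zero j * per (minor P j))
      ≡⟨ cong (λ x → ∏ r * x * (P zero j * per (minor P j))) (sym (∏-punchIn c j)) ⟩
    ∏ r * ∏ c * (P zero j * per (minor P j))
      ∎

per-signScale : ∀ {n} (s : Fin n → ℤ) (P : Matrix n) → (∀ i → s i * s i ≡ 1ℤ) →
  per (λ i j → s i * s j * P i j) ≡ per P
per-signScale s P s²≡1 =
  trans (per-scale s s P) (trans (cong (_* per P) (∏-square≡1 s s²≡1)) (*-identityˡ (per P)))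

∘ₕ-self-signScale : ∀ {n} (s : Fin n → ℤ) (P : Matrix n) → (∀ i → s i * s i ≡ 1ℤ) →
  ∀ i j → (s i * s j * P i j) * (s i * s j * P i j) ≡ (P ∘ₕ P) i j
∘ₕ-self-signScale s P s²≡1 i j = begin
  (s i * s j * P i j) * (s i * s j * P i j)   ≡⟨ interchange (s i) (s j) (P i j) ⟩
  (s i * s i) * (s j * s j) * (P i j * P i j) ≡⟨ cong₂ (λ a b → a * b * (P ∘ₕ P) i j) (s²≡1 i) (s²≡1 j) ⟩
  1ℤ * 1ℤ * (P ∘ₕ P) i j                      ≡⟨ *-identityˡ _ ⟩
  (P ∘ₕ P) i j                                ∎
  where
  open ≡-Reasoning
  interchange : ∀ a b p → (a * b * p) * (a * b * p) ≡ (a * a) * (b * b) * (p * p)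
  interchange = solve-∀

per[P∘ₕP]≤per[P]² : ∀ {n} (P : Matrix n) → (∀ i j → 0ℤ ≤ P i j) →
  per (P ∘ₕ P) ≤ per P * per P
per[P∘ₕP]≤per[P]² {zero}  P 0≤P = ≤-refl
per[P∘ₕP]≤per[P]² {suc n} P 0≤P = begin
  ∑ (λ j → (p j * p j) * per (minor P j ∘ₕ minor P j))
    ≤⟨ ∑-mono-≤ (λ j → *-monoˡ-≤-nonNeg (p j * p j) {{nonNegative (0≤i*j (0≤P zero j) (0≤P zero j))}}
                         (per[P∘ₕP]≤per[P]² (minor P j) (0≤minor j))) ⟩
  ∑ (λ j → (p j * p j) * (per (minor P j) * per (minor P j)))
    ≡⟨ ∑-cong (λ j → interchange (p j) (per (minor P j))) ⟩
  ∑ (λ j → (p j * per (minor P j)) * (p j * per (minor P j)))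
    ≤⟨ ∑-square≤square-∑ _ (λ j → 0≤i*j (0≤P zero j) (0≤per (minor P j) (0≤minor j))) ⟩
  per P * per P
    ∎
  where
  open ≤-Reasoning
  p : Fin (suc n) → ℤ
  p = P zero
  0≤minor : ∀ j i k → 0ℤ ≤ minor P j i k
  0≤minor j i k = 0≤P (suc i) (punchIn j k)
  interchange : ∀ a b → (a * a) * (b * b) ≡ (a * b) * (a * b)
  interchange = solve-∀

signlessLaplacian : ∀ {n} → SimpleGraph n → Matrix n
signlessLaplacian G i j = degMatrix G i j + adjMatrix G i j

0≤toℤ : ∀ b → 0ℤ ≤ toℤ b
0≤toℤ true  = +≤+ z≤n
0≤toℤ false = +≤+ z≤n

0≤signlessLaplacian : ∀ {n} (G : SimpleGraph n) i j → 0ℤ ≤ signlessLaplacian G i j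
0≤signlessLaplacian G i j with i ≟ j
... | yes _ = +-mono-≤ (0≤∑ (λ k → 0≤toℤ (adj G i k))) (0≤toℤ (adj G i j))
... | no  _ = +-mono-≤ (+≤+ z≤n) (0≤toℤ (adj G i j))

sign : Bool → ℤ
sign true  = 1ℤ
sign false = -1ℤ

sign*sign≡1 : ∀ b → sign b * sign b ≡ 1ℤ
sign*sign≡1 true  = refl
sign*sign≡1 false = refl

laplacian≡signScale-signless : ∀ {n} (G : SimpleGraph n) (c : Fin n → Bool) →
  (∀ i j → adj G i j ≡ true → c i ≢ c j) →
  ∀ i j → laplacian G i j ≡ sign (c i) * sign (c j) * signlessLaplacian G i j
laplacian≡signScale-signless G c proper i j with i ≟ j
... | yes refl rewrite loopless G i | sign*sign≡1 (c i) =
  trans (+-identityʳ (degree G i)) (sym (trans (*-identityˡ _) (+-identityʳ (degree G i))))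
... | no  _ = offDiagonal (adj G i j) (c i) (c j) (proper i j)
  where
  offDiagonal : ∀ a ci cj → (a ≡ true → ci ≢ cj) → + 0 - toℤ a ≡ sign ci * sign cj * (+ 0 + toℤ a)
  offDiagonal false ci    cj    _      = sym (*-zeroʳ (sign ci * sign cj))
  offDiagonal true  true  true  proper = ⊥-elim (proper refl refl)
  offDiagonal true  true  false _      = refl
  offDiagonal true  false true  _      = refl
  offDiagonal true  false false proper = ⊥-elim (proper refl refl)

corollary3p2 : ∀ (n : ℕ) (G : SimpleGraph n) → IsBipartite G →
    per (laplacian G ∘ₕ laplacian G) ≤ per (laplacian G) * per (laplacian G)
corollary3p2 n G (c , proper) = begin
  per (L ∘ₕ L)  ≡⟨ per-cong (λ i j → trans (cong₂ _*_ (L≡SQS i j) (L≡SQS i j))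
                                           (∘ₕ-self-signScale s Q s²≡1 i j)) ⟩
  per (Q ∘ₕ Q)  ≤⟨ per[P∘ₕP]≤per[P]² Q (0≤signlessLaplacian G) ⟩
  per Q * per Q ≡⟨ sym (cong₂ _*_ perL≡perQ perL≡perQ) ⟩
  per L * per L ∎
  where
  open ≤-Reasoning
  L Q : Matrix n
  L = laplacian G
  Q = signlessLaplacian G
  s : Fin n → ℤ
  s i = sign (c i)
  s²≡1 : ∀ i → s i * s i ≡ 1ℤ
  s²≡1 i = sign*sign≡1 (c i)
  L≡SQS : ∀ i j → L i j ≡ s i * s j * Q i j
  L≡SQS = laplacian≡signScale-signless G c proper
  perL≡perQ : per L ≡ per Q
  perL≡perQ = trans (per-cong L≡SQS) (per-signScale s Q s²≡1)
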